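{- Let $k,d,n$ be positive integers with $2k = d$. Then the number of distinct functions in $\{\mathbbm{1}_{S^d} : S \in \mathcal{I}_k\}$ equals the number of distinct functions in $\{\mathbbm{1}_{V(T)} : T \subset [n],\ 1 \le |T| \le d\}$.
   Context: $[n]=\{1,\dots,n\}$; for integers $a \le b$, $[a,b]=\{a,\dots,b\}$ is an interval. $\mathcal{I}_k$ denotes the set of non-empty subsets of $[n]$ that are unions of at most $k$ intervals. $S^d = S \times\dots\times S\subset [n]^d$, and $\mathbbm{1}_X$ is the indicator function of $X$ on $[n]^d$. For $T \subset [n]$, $V(T)$ is the set of $x=(x_1,\dots,x_d) \in [n]^d$ such that $\{x_1,\dots,x_d\} = T$. -}

module Defs where

open import Data.Nat as ℕ using (ℕ; _≤_)
open import Data.Fin as F using (Fin; _≟_)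
open import Data.Fin.Subset using (Subset; _∈_; Nonempty)
open import Data.Fin.Subset.Properties using (_∈?_)
open import Data.Bool using (Bool)
open import Data.Vec using (Vec; tabulate)
import Data.Vec.Properties as VecP
open import Data.Vec.Relation.Unary.All as All using (All)
import Data.Vec.Relation.Unary.Any as VAny
open import Data.List using (List; length)
open import Data.List.Relation.Unary.Any using (Any)
open import Data.Product using (Σ; ∃; _×_; proj₁)
open import Function.Bundles using (_⇔_)
open import Relation.Nullary.Decidable using (⌊_⌋)
open import Relation.Binary.PropositionalEquality using (_≡_; _≗_)
import Data.Bool.Properties as BoolP

-- [n] is modelled by Fin n (0-based); subsets of [n] by Subset n.
-- Points of [n]^d are vectors Vec (Fin n) d.

Point : ℕ → ℕ → Set
Point n d = Vec (Fin n) d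

Interval : ℕ → Set
Interval n = Σ (Fin n × Fin n) λ ab → proj₁ ab F.≤ Data.Product.proj₂ ab

inInterval : ∀ {n} → Fin n → Interval n → Set
inInterval x ((a Data.Product., b) Data.Product., _) = (a F.≤ x) × (x F.≤ b)

InI : (k : ℕ) → {n : ℕ} → Subset n → Set
InI k {n} S =
  Nonempty S ×
  ∃ λ (L : List (Interval n)) →
    (length L ≤ k) × (∀ x → (x ∈ S) ⇔ Any (inInterval x) L)

indCube : ∀ {n d} → Subset n → Point n d → Bool
indCube S x = ⌊ All.all? (_∈? S) x ⌋

coords : ∀ {n d} → Point n d → Subset n
coords x = tabulate λ t → ⌊ VAny.any? (λ xi → xi ≟ t) x ⌋

indV : ∀ {n d} → Subset n → Point n d → Bool
indV T x = ⌊ VecP.≡-dec BoolP._≟_ (coords x) T ⌋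

-- "The family {F i : i ∈ I, P i} of functions X → Bool contains exactly
-- m distinct functions (distinct = extensionally different)":
-- there is an enumeration g of m admissible indices whose functions are
-- pairwise distinct and such that every member of the family is one of them.
ImageSize : {X I : Set} → (I → Set) → (I → X → Bool) → ℕ → Set
ImageSize {X} {I} P F m =
  Σ (Fin m → Σ I P) λ g →
    (∀ j j′ → F (proj₁ (g j)) ≗ F (proj₁ (g j′)) → j ≡ j′) ×
    (∀ i → P i → ∃ λ j → F i ≗ F (proj₁ (g j)))

-- The maps S ↦ 𝟙_{S^d} (d ≥ 1) and T ↦ 𝟙_{V(T)} (for 1 ≤ |T| ≤ d) are injective, so both
-- families have as many distinct members as they have admissible indices.  These index sets are
-- in bijection: send S to the set of positions where its indicator sequence changes value (with
-- position 0 compared to an imaginary 0 before it).  If S has c maximal runs, this set has 2c or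
-- 2c − 1 elements, and S is a union of at most k intervals iff it is non-empty with c ≤ k, i.e.
-- iff its change set has between 1 and 2k elements.
module Submission where

open import Defs
open import Data.Nat using (ℕ; zero; suc; _+_; _*_; _≤_; _<_; z≤n; s≤s; _≤?_)
open import Data.Nat.Properties
open import Data.Nat.Tactic.RingSolver using (solve-∀)
open import Data.Bool using (Bool; true; false; not; _∧_; _xor_; T)
open import Data.Bool.Properties using (xor-assoc; xor-same; T-≡)
open import Data.Fin as F using (Fin; toℕ; inject₁)
open import Data.Fin.Properties
  using (toℕ-injective; toℕ-inject₁) renaming (suc-injective to Fin-suc-injective)
open import Data.Fin.Subset using (Subset; ∣_∣; Nonempty; _∈_; _∉_; _⊆_; _∪_; ⊥; ⁅_⁆)
open import Data.Fin.Subset.Properties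
  using ( ⊆-antisym; p⊆q⇒∣p∣≤∣q∣; ∣p∣≤∣x∷p∣; ∣⊥∣≡0; ∣⁅x⁆∣≡1; x∈⁅x⁆; x∈⁅y⁆⇒x≡y; x∈p∪q⁺
        ; nonempty?; Empty-unique)
open import Data.Vec as V using (Vec; []; _∷_; here; there)
open import Data.Vec.Properties using (lookup∘tabulate; []=⇒lookup; lookup⇒[]=; ∷-injectiveʳ)
import Data.Vec.Relation.Unary.All as VAll
import Data.Vec.Relation.Unary.Any as VAny
import Data.Vec.Relation.Unary.Any.Properties as VAnyP
open import Data.List as L using (List; []; _∷_; length; filter; _++_)
open import Data.List.Properties using (length-map)
open import Data.List.Relation.Unary.All as LAll using ([])
open import Data.List.Relation.Unary.All.Properties using (all-filter)
open import Data.List.Relation.Unary.Any as LAny using (Any; here; there)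
import Data.List.Relation.Unary.Any.Properties as LAnyP
open import Data.List.Relation.Unary.Unique.Propositional using (Unique; []; _∷_)
import Data.List.Relation.Unary.Unique.Propositional.Properties as Unique
open import Data.List.Membership.Propositional using (find; lose) renaming (_∈_ to _∈ˡ_)
open import Data.List.Membership.Propositional.Properties
  using (∈-lookup; ∈-filter⁺; ∈-map⁺; ∈-map⁻; ∈-++⁺ˡ; ∈-++⁺ʳ)
open import Data.Product using (Σ; ∃; _×_; _,_; proj₁; proj₂)
import Data.Product as Prod
open import Data.Sum as Sum using (_⊎_; inj₁; inj₂)
open import Data.Empty using (⊥-elim)
open import Function using (_∘_; _$_; id)
open import Function.Bundles using (_⇔_; mk⇔; Equivalence)
open import Function.Definitions using (Injective)
import Function.Properties.Equivalence as ⇔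
open import Data.Product.Function.NonDependent.Propositional using (_×-⇔_)
open import Relation.Nullary using (¬_; yes; no; contradiction; _×-dec_)
open import Relation.Nullary.Decidable using (fromWitness; toWitness)
open import Relation.Unary using (Decidable)
open import Relation.Binary.PropositionalEquality

open Equivalence using (to; from)

-- Counting the distinct members of an injective family

InjectiveOn : {X I : Set} → (I → Set) → (I → X → Bool) → Set
InjectiveOn P F = ∀ {i i′} → P i → P i′ → F i ≗ F i′ → i ≡ i′

Enumeration : {I : Set} → (I → Set) → ℕ → Set
Enumeration {I} P m = Σ (Fin m → Σ I P) λ e →
  Injective _≡_ _≡_ (proj₁ ∘ e) × (∀ i → P i → ∃ λ j → proj₁ (e j) ≡ i)

imageSize-injective : {X I : Set} {P : I → Set} {F : I → X → Bool} {m : ℕ} →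
  InjectiveOn P F → Enumeration P m → ImageSize P F m
imageSize-injective {P = P} {F = F} F-inj (e , e-inj , e-onto) = e , distinct , covered
  where
  distinct : ∀ j j′ → F (proj₁ (e j)) ≗ F (proj₁ (e j′)) → j ≡ j′
  distinct j j′ Fj≗Fj′ = e-inj (F-inj (proj₂ (e j)) (proj₂ (e j′)) Fj≗Fj′)
  covered : ∀ i → P i → ∃ λ j → F i ≗ F (proj₁ (e j))
  covered i p with e-onto i p
  ... | j , refl = j , λ _ → refl

enumeration-inverse : {I : Set} {P Q : I → Set} {m : ℕ} (f g : I → I) →
  (∀ i → f (g i) ≡ i) → (∀ i → g (f i) ≡ i) →
  (∀ {i} → Q i → P (f i)) → (∀ {i} → P i → Q (g i)) →
  Enumeration P m → Enumeration Q m
enumeration-inverse {I} {Q = Q} {m} f g fg gf Q⇒P P⇒Q (e , e-inj , e-onto) = e′ , e′-inj , e′-onto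
  where
  e′ : Fin m → Σ I Q
  e′ j = g (proj₁ (e j)) , P⇒Q (proj₂ (e j))
  e′-inj : Injective _≡_ _≡_ (proj₁ ∘ e′)
  e′-inj eq = e-inj (trans (sym (fg _)) (trans (cong f eq) (fg _)))
  e′-onto : ∀ i → Q i → ∃ λ j → proj₁ (e′ j) ≡ i
  e′-onto i q with e-onto (f i) (Q⇒P q)
  ... | j , e[j]≡fi = j , trans (cong g e[j]≡fi) (gf i)

lookup-injective : {A : Set} {xs : List A} → Unique xs → Injective _≡_ _≡_ (L.lookup xs)
lookup-injective (_  ∷ _)   {F.zero}  {F.zero}  _  = refl
lookup-injective (x∉ ∷ _)   {F.zero}  {F.suc j} eq = ⊥-elim (LAll.lookup x∉ (∈-lookup j) eq)
lookup-injective (x∉ ∷ _)   {F.suc i} {F.zero}  eq = ⊥-elim (LAll.lookup x∉ (∈-lookup i) (sym eq))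
lookup-injective (_  ∷ xs!) {F.suc i} {F.suc j} eq = cong F.suc (lookup-injective xs! eq)

enumeration-filter : {I : Set} {P : I → Set} (P? : Decidable P) {xs : List I} →
  Unique xs → (∀ i → i ∈ˡ xs) → Enumeration P (length (filter P? xs))
enumeration-filter {I} {P} P? {xs} xs! complete = e , lookup-injective (Unique.filter⁺ P? xs!) , e-onto
  where
  e : Fin (length (filter P? xs)) → Σ I P
  e j = L.lookup (filter P? xs) j , LAll.lookup (all-filter P? xs) (∈-lookup j)
  e-onto : ∀ i → P i → ∃ λ j → proj₁ (e j) ≡ i
  e-onto i p = LAny.index i∈ , sym (LAnyP.lookup-index i∈)
    where
    i∈ : i ∈ˡ filter P? xs
    i∈ = ∈-filter⁺ P? (complete i) p

allSubsets : ∀ n → List (Subset n)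
allSubsets zero    = [] ∷ []
allSubsets (suc n) = L.map (true ∷_) (allSubsets n) ++ L.map (false ∷_) (allSubsets n)

allSubsets-unique : ∀ n → Unique (allSubsets n)
allSubsets-unique zero    = [] ∷ []
allSubsets-unique (suc n) =
  Unique.++⁺ (Unique.map⁺ ∷-injectiveʳ (allSubsets-unique n)) (Unique.map⁺ ∷-injectiveʳ (allSubsets-unique n))
    heads-differ
  where
  heads-differ : ∀ {s} → ¬ (s ∈ˡ L.map (true ∷_) (allSubsets n) × s ∈ˡ L.map (false ∷_) (allSubsets n))
  heads-differ (s∈ , s∈′) with ∈-map⁻ (true ∷_) s∈ | ∈-map⁻ (false ∷_) s∈′
  ... | _ , _ , refl | _ , _ , ()

∈-allSubsets : ∀ {n} (s : Subset n) → s ∈ˡ allSubsets n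
∈-allSubsets []          = here refl
∈-allSubsets (true ∷ s)  = ∈-++⁺ˡ (∈-map⁺ (true ∷_) (∈-allSubsets s))
∈-allSubsets (false ∷ s) = ∈-++⁺ʳ (L.map (true ∷_) _) (∈-map⁺ (false ∷_) (∈-allSubsets s))

-- Change sets and runs of a bit sequence

-- The parameter p of the functions below is the bit just before position 0.

changes : ∀ {n} → Bool → Subset n → Subset n
changes p []      = []
changes p (b ∷ s) = (p xor b) ∷ changes b s

accumulate : ∀ {n} → Bool → Subset n → Subset n
accumulate p []      = []
accumulate p (t ∷ u) = (p xor t) ∷ accumulate (p xor t) u

runStarts : ∀ {n} → Bool → Subset n → Subset n
runStarts p []      = []
runStarts p (b ∷ s) = (b ∧ not p) ∷ runStarts b s

lastBit : ∀ {n} → Bool → Subset n → Bool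
lastBit p []      = p
lastBit p (b ∷ s) = lastBit b s

xor-cancelˡ : ∀ p t → p xor (p xor t) ≡ t
xor-cancelˡ p t = trans (sym (xor-assoc p p t)) (cong (_xor t) (xor-same p))

changes-accumulate : ∀ {n} p (u : Subset n) → changes p (accumulate p u) ≡ u
changes-accumulate p []      = refl
changes-accumulate p (t ∷ u) rewrite xor-cancelˡ p t = cong (t ∷_) (changes-accumulate (p xor t) u)

accumulate-changes : ∀ {n} p (s : Subset n) → accumulate p (changes p s) ≡ s
accumulate-changes p []      = refl
accumulate-changes p (b ∷ s) rewrite xor-cancelˡ p b = cong (b ∷_) (accumulate-changes b s)

Bool→ℕ : Bool → ℕ
Bool→ℕ false = 0
Bool→ℕ true  = 1

Bool→ℕ≤1 : ∀ b → Bool→ℕ b ≤ 1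
Bool→ℕ≤1 false = z≤n
Bool→ℕ≤1 true  = s≤s z≤n

-- Each run contributes its two ends to the change set, except that a run reaching the end
-- of the sequence has no closing change, and a run already open before position 0 no opening one.
∣changes∣+lastBit≡2*∣runStarts∣+p : ∀ {n} p (s : Subset n) →
  ∣ changes p s ∣ + Bool→ℕ (lastBit p s) ≡ 2 * ∣ runStarts p s ∣ + Bool→ℕ p
∣changes∣+lastBit≡2*∣runStarts∣+p p     []          = refl
∣changes∣+lastBit≡2*∣runStarts∣+p false (false ∷ s) = ∣changes∣+lastBit≡2*∣runStarts∣+p false s
∣changes∣+lastBit≡2*∣runStarts∣+p false (true ∷ s)  =
  trans (cong suc (∣changes∣+lastBit≡2*∣runStarts∣+p true s)) (open-run ∣ runStarts true s ∣)
  where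
  open-run : ∀ r → suc (2 * r + 1) ≡ 2 * suc r + 0
  open-run = solve-∀
∣changes∣+lastBit≡2*∣runStarts∣+p true  (false ∷ s) =
  trans (cong suc (∣changes∣+lastBit≡2*∣runStarts∣+p false s)) (close-run ∣ runStarts false s ∣)
  where
  close-run : ∀ r → suc (2 * r + 0) ≡ 2 * r + 1
  close-run = solve-∀
∣changes∣+lastBit≡2*∣runStarts∣+p true  (true ∷ s)  = ∣changes∣+lastBit≡2*∣runStarts∣+p true s

runStarts⊆ : ∀ {n} p (s : Subset n) → runStarts p s ⊆ s
runStarts⊆ false (true ∷ s)  here       = here
runStarts⊆ p     (false ∷ s) (there x∈) = there (runStarts⊆ false s x∈)
runStarts⊆ p     (true ∷ s)  (there x∈) = there (runStarts⊆ true s x∈)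

nonempty⇒runStart : ∀ {n} p (s : Subset n) → Nonempty s → p ≡ true ⊎ Nonempty (runStarts p s)
nonempty⇒runStart false (true ∷ s) (F.zero , here) = inj₂ (F.zero , here)
nonempty⇒runStart true  (true ∷ s) (F.zero , here) = inj₁ refl
nonempty⇒runStart p     (b ∷ s)    (F.suc x , there x∈) with nonempty⇒runStart b s (x , x∈)
... | inj₂ (y , y∈) = inj₂ (F.suc y , there y∈)
nonempty⇒runStart false (true ∷ s) _ | inj₁ refl = inj₂ (F.zero , here)
nonempty⇒runStart true  (true ∷ s) _ | inj₁ refl = inj₁ refl

runStart-pred∉ : ∀ {n} p (s : Subset (suc n)) {x : Fin n} → F.suc x ∈ runStarts p s → inject₁ x ∉ s
runStart-pred∉ p (true ∷ true ∷ s)  {F.zero}  (there ()) here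
runStart-pred∉ p (true ∷ false ∷ s) {F.zero}  (there ()) here
runStart-pred∉ p (b ∷ s)            {F.suc x} (there x∈) (there px∈) = runStart-pred∉ b s x∈ px∈

≤2*⇔halved≤ : ∀ {D l c} → D + l ≡ 2 * c → l ≤ 1 → ∀ k → D ≤ 2 * k ⇔ c ≤ k
≤2*⇔halved≤ {D} {l} {c} D+l≡2c l≤1 k = mk⇔ halve double
  where
  open ≤-Reasoning
  2k+1<2[1+k] : 2 * k + 1 < 2 * suc k
  2k+1<2[1+k] = ≤-reflexive (2[1+k] k)
    where
    2[1+k] : ∀ k → suc (2 * k + 1) ≡ 2 * suc k
    2[1+k] = solve-∀
  halve : D ≤ 2 * k → c ≤ k
  halve D≤2k = ≤-pred $ *-cancelˡ-< 2 c (suc k) $ begin-strict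
    2 * c     ≡⟨ sym D+l≡2c ⟩
    D + l     ≤⟨ +-mono-≤ D≤2k l≤1 ⟩
    2 * k + 1 <⟨ 2k+1<2[1+k] ⟩
    2 * suc k ∎
  double : c ≤ k → D ≤ 2 * k
  double c≤k = begin
    D     ≤⟨ m≤m+n D l ⟩
    D + l ≡⟨ D+l≡2c ⟩
    2 * c ≤⟨ *-monoʳ-≤ 2 c≤k ⟩
    2 * k ∎

1≤⇔1≤halved : ∀ {D l c} → D + l ≡ 2 * c → l ≤ 1 → 1 ≤ D ⇔ 1 ≤ c
1≤⇔1≤halved {D} {l} {c} D+l≡2c l≤1 = mk⇔ (positive c D+l≡2c) (positive′ D D+l≡2c)
  where
  positive : ∀ c → D + l ≡ 2 * c → 1 ≤ D → 1 ≤ c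
  positive (suc _) _    _   = s≤s z≤n
  positive zero    D+l≡0 1≤D with () ← subst (1 ≤_) (m+n≡0⇒m≡0 D D+l≡0) 1≤D
  positive′ : ∀ D → D + l ≡ 2 * c → 1 ≤ c → 1 ≤ D
  positive′ (suc _) _   _   = s≤s z≤n
  positive′ zero    l≡2c 1≤c =
    contradiction (≤-trans (*-monoʳ-≤ 2 1≤c) (≤-trans (≤-reflexive (sym l≡2c)) l≤1)) (<-irrefl refl)

nonempty⇔1≤∣p∣ : ∀ {n} {p : Subset n} → Nonempty p ⇔ 1 ≤ ∣ p ∣
nonempty⇔1≤∣p∣ {n} {p} = mk⇔ one≤ nonempty
  where
  one≤ : Nonempty p → 1 ≤ ∣ p ∣
  one≤ (x , x∈p) =
    subst (_≤ ∣ p ∣) (∣⁅x⁆∣≡1 x) (p⊆q⇒∣p∣≤∣q∣ λ y∈⁅x⁆ → subst (_∈ p) (sym (x∈⁅y⁆⇒x≡y x y∈⁅x⁆)) x∈p)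
  nonempty : 1 ≤ ∣ p ∣ → Nonempty p
  nonempty 1≤∣p∣ with nonempty? p
  ... | yes ne = ne
  ... | no  empty with () ← subst (1 ≤_) (trans (cong ∣_∣ (Empty-unique empty)) (∣⊥∣≡0 n)) 1≤∣p∣

nonempty⇔1≤∣runStarts∣ : ∀ {n} (s : Subset n) → Nonempty s ⇔ 1 ≤ ∣ runStarts false s ∣
nonempty⇔1≤∣runStarts∣ s = mk⇔ one≤ nonempty
  where
  one≤ : Nonempty s → 1 ≤ ∣ runStarts false s ∣
  one≤ ne with nonempty⇒runStart false s ne
  ... | inj₂ ne′ = to nonempty⇔1≤∣p∣ ne′
  nonempty : 1 ≤ ∣ runStarts false s ∣ → Nonempty s
  nonempty 1≤∣R∣ = Prod.map₂ (runStarts⊆ false s) (from nonempty⇔1≤∣p∣ 1≤∣R∣)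

changes-bounded⇔ : ∀ k {n} (s : Subset n) →
  (1 ≤ ∣ changes false s ∣ × ∣ changes false s ∣ ≤ 2 * k) ⇔ (Nonempty s × ∣ runStarts false s ∣ ≤ k)
changes-bounded⇔ k s =
  ⇔.trans (1≤⇔1≤halved D+l≡2c l≤1) (⇔.sym (nonempty⇔1≤∣runStarts∣ s)) ×-⇔ ≤2*⇔halved≤ D+l≡2c l≤1 k
  where
  D+l≡2c : ∣ changes false s ∣ + Bool→ℕ (lastBit false s) ≡ 2 * ∣ runStarts false s ∣
  D+l≡2c = trans (∣changes∣+lastBit≡2*∣runStarts∣+p false s) (+-identityʳ _)
  l≤1 : Bool→ℕ (lastBit false s) ≤ 1
  l≤1 = Bool→ℕ≤1 (lastBit false s)

-- Unions of intervals

lower : ∀ {n} → Interval n → Fin n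
lower ((a , _) , _) = a

Covers : ∀ {n} → List (Interval n) → Subset n → Set
Covers L S = ∀ x → x ∈ S ⇔ Any (inInterval x) L

starts : ∀ {n} → List (Interval n) → Subset n
starts []      = ⊥
starts (I ∷ L) = ⁅ lower I ⁆ ∪ starts L

∣p∪q∣≤∣p∣+∣q∣ : ∀ {n} (p q : Subset n) → ∣ p ∪ q ∣ ≤ ∣ p ∣ + ∣ q ∣
∣p∪q∣≤∣p∣+∣q∣ []          []          = z≤n
∣p∪q∣≤∣p∣+∣q∣ (true ∷ p)  (b ∷ q)     =
  s≤s (≤-trans (∣p∪q∣≤∣p∣+∣q∣ p q) (+-monoʳ-≤ ∣ p ∣ (∣p∣≤∣x∷p∣ b q)))
∣p∪q∣≤∣p∣+∣q∣ (false ∷ p) (false ∷ q) = ∣p∪q∣≤∣p∣+∣q∣ p q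
∣p∪q∣≤∣p∣+∣q∣ (false ∷ p) (true ∷ q)  =
  ≤-trans (s≤s (∣p∪q∣≤∣p∣+∣q∣ p q)) (≤-reflexive (sym (+-suc ∣ p ∣ ∣ q ∣)))

∣starts∣≤length : ∀ {n} (L : List (Interval n)) → ∣ starts L ∣ ≤ length L
∣starts∣≤length {n} []  = ≤-reflexive (∣⊥∣≡0 n)
∣starts∣≤length (I ∷ L) =
  ≤-trans (∣p∪q∣≤∣p∣+∣q∣ ⁅ lower I ⁆ (starts L))
          (+-mono-≤ (≤-reflexive (∣⁅x⁆∣≡1 (lower I))) (∣starts∣≤length L))

lower∈starts : ∀ {n} {I : Interval n} {L} → I ∈ˡ L → lower I ∈ starts L
lower∈starts {L = _ ∷ L} (here refl) = x∈p∪q⁺ {q = starts L} (inj₁ (x∈⁅x⁆ _))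
lower∈starts             (there I∈L) = x∈p∪q⁺ (inj₂ (lower∈starts I∈L))

-- An interval of a cover containing a run start x must begin at x: otherwise it would also
-- contain the predecessor of x, which is not in the set.
runStart-lower : ∀ {n} {L : List (Interval n)} {S : Subset n} → Covers L S →
  ∀ {x I} → x ∈ runStarts false S → I ∈ˡ L → inInterval x I → lower I ≡ x
runStart-lower cover {F.zero} x∈R I∈L (a≤0 , _) = toℕ-injective (n≤0⇒n≡0 a≤0)
runStart-lower {S = S} cover {F.suc x} {(a , b) , _} x∈R I∈L (a≤1+x , 1+x≤b) with m≤n⇒m<n∨m≡n a≤1+x
... | inj₂ a≡1+x = toℕ-injective a≡1+x
... | inj₁ a<1+x =
  contradiction (from (cover (inject₁ x)) (lose I∈L (a≤x , x≤b))) (runStart-pred∉ false S x∈R)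
  where
  a≤x : toℕ a ≤ toℕ (inject₁ x)
  a≤x = subst (toℕ a ≤_) (sym (toℕ-inject₁ x)) (≤-pred a<1+x)
  x≤b : toℕ (inject₁ x) ≤ toℕ b
  x≤b = subst (_≤ toℕ b) (sym (toℕ-inject₁ x)) (≤-trans (n≤1+n _) 1+x≤b)

runStarts⊆starts : ∀ {n} {L : List (Interval n)} {S : Subset n} → Covers L S → runStarts false S ⊆ starts L
runStarts⊆starts {L = L} {S} cover x∈R with find (to (cover _) (runStarts⊆ false S x∈R))
... | I , I∈L , x∈I = subst (_∈ starts L) (runStart-lower cover x∈R I∈L x∈I) (lower∈starts I∈L)

shift : ∀ {n} → Interval n → Interval (suc n)
shift ((a , b) , a≤b) = (F.suc a , F.suc b) , s≤s a≤b

shift⁺ : ∀ {n} {L : List (Interval n)} {y} → Any (inInterval y) L → Any (inInterval (F.suc y)) (L.map shift L)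
shift⁺ = LAnyP.map⁺ ∘ LAny.map (Prod.map s≤s s≤s)

shift⁻ : ∀ {n} {L : List (Interval n)} {y} → Any (inInterval (F.suc y)) (L.map shift L) → Any (inInterval y) L
shift⁻ = LAny.map (Prod.map ≤-pred ≤-pred) ∘ LAnyP.map⁻

zero∉shift : ∀ {n} (L : List (Interval n)) → ¬ Any (inInterval F.zero) (L.map shift L)
zero∉shift (I ∷ L) (here (() , _))
zero∉shift (I ∷ L) (there 0∈) = zero∉shift L 0∈

leadingTrues : ∀ {n} → Subset n → Fin (suc n)
leadingTrues []          = F.zero
leadingTrues (false ∷ s) = F.zero
leadingTrues (true ∷ s)  = F.suc (leadingTrues s)

-- One interval per run start.  When p = true the initial run of s, the positions below
-- leadingTrues s, continues a run from before position 0 and gets no interval of its own.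
runIntervals : ∀ {n} → Bool → Subset n → List (Interval n)
runIntervals p     []          = []
runIntervals p     (false ∷ s) = L.map shift (runIntervals false s)
runIntervals true  (true ∷ s)  = L.map shift (runIntervals true s)
runIntervals false (true ∷ s)  = ((F.zero , leadingTrues s) , z≤n) ∷ L.map shift (runIntervals true s)

length-runIntervals : ∀ {n} p (s : Subset n) → length (runIntervals p s) ≡ ∣ runStarts p s ∣
length-runIntervals p     []          = refl
length-runIntervals p     (false ∷ s) = trans (length-map shift (runIntervals false s)) (length-runIntervals false s)
length-runIntervals true  (true ∷ s)  = trans (length-map shift (runIntervals true s)) (length-runIntervals true s)
length-runIntervals false (true ∷ s)  =
  cong suc (trans (length-map shift (runIntervals true s)) (length-runIntervals true s))

Covered : ∀ {n} → Bool → Subset n → Fin n → Set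
Covered p s y = (p ≡ true × toℕ y < toℕ (leadingTrues s)) ⊎ Any (inInterval y) (runIntervals p s)

covered-false : ∀ {n} {s : Subset n} {y} → Covered false s y → Any (inInterval y) (runIntervals false s)
covered-false (inj₁ (() , _))
covered-false (inj₂ y∈) = y∈

∈⇒covered : ∀ {n} p (s : Subset n) {y} → y ∈ s → Covered p s y
∈⇒covered true  (true ∷ s)  here        = inj₁ (refl , s≤s z≤n)
∈⇒covered false (true ∷ s)  here        = inj₂ (here (z≤n , z≤n))
∈⇒covered p     (false ∷ s) (there y∈s) = inj₂ (shift⁺ (covered-false (∈⇒covered false s y∈s)))
∈⇒covered true  (true ∷ s)  (there y∈s) = Sum.map (Prod.map₂ s≤s) shift⁺ (∈⇒covered true s y∈s)
∈⇒covered false (true ∷ s)  (there y∈s) =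
  inj₂ (Sum.[ (λ (_ , y<ℓ) → here (z≤n , y<ℓ)) , there ∘ shift⁺ ] (∈⇒covered true s y∈s))

covered⇒∈ : ∀ {n} p (s : Subset n) {y} → Covered p s y → y ∈ s
covered⇒∈ p     (false ∷ s) (inj₁ (_ , ()))
covered⇒∈ p     (false ∷ s) {F.zero}  (inj₂ 0∈)  = ⊥-elim (zero∉shift _ 0∈)
covered⇒∈ p     (false ∷ s) {F.suc y} (inj₂ y∈)  = there (covered⇒∈ false s (inj₂ (shift⁻ y∈)))
covered⇒∈ p     (true ∷ s)  {F.zero}  _          = here
covered⇒∈ true  (true ∷ s)  {F.suc y} y∈         =
  there (covered⇒∈ true s (Sum.map (Prod.map₂ ≤-pred) shift⁻ y∈))
covered⇒∈ false (true ∷ s)  (inj₁ (() , _))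
covered⇒∈ false (true ∷ s)  {F.suc y} (inj₂ (here (_ , y<ℓ))) = there (covered⇒∈ true s (inj₁ (refl , y<ℓ)))
covered⇒∈ false (true ∷ s)  {F.suc y} (inj₂ (there y∈))      = there (covered⇒∈ true s (inj₂ (shift⁻ y∈)))

InI⇔runs≤ : ∀ k {n} (S : Subset n) → InI k S ⇔ (Nonempty S × ∣ runStarts false S ∣ ≤ k)
InI⇔runs≤ k S = mk⇔ runs≤ union
  where
  runs≤ : InI k S → Nonempty S × ∣ runStarts false S ∣ ≤ k
  runs≤ (ne , L , ∣L∣≤k , cover) =
    ne , ≤-trans (p⊆q⇒∣p∣≤∣q∣ (runStarts⊆starts cover)) (≤-trans (∣starts∣≤length L) ∣L∣≤k)
  union : Nonempty S × ∣ runStarts false S ∣ ≤ k → InI k S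
  union (ne , ∣R∣≤k) = ne , runIntervals false S , ∣L∣≤k , cover
    where
    ∣L∣≤k : length (runIntervals false S) ≤ k
    ∣L∣≤k = subst (_≤ k) (sym (length-runIntervals false S)) ∣R∣≤k
    cover : Covers (runIntervals false S) S
    cover x = mk⇔ (covered-false ∘ ∈⇒covered false S) (covered⇒∈ false S ∘ inj₂)

InI⇔changes-bounded : ∀ k {n} (S : Subset n) →
  InI k S ⇔ (1 ≤ ∣ changes false S ∣ × ∣ changes false S ∣ ≤ 2 * k)
InI⇔changes-bounded k S = ⇔.trans (InI⇔runs≤ k S) (⇔.sym (changes-bounded⇔ k S))

-- Injectivity of the indicator maps

all-replicate : ∀ {A : Set} {P : A → Set} {a} d → P a → VAll.All P (V.replicate d a)
all-replicate zero    pa = VAll.[]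
all-replicate (suc d) pa = pa VAll.∷ all-replicate d pa

indCube-injective : ∀ {n d} → 1 ≤ d → ∀ {S S′ : Subset n} → indCube {n} {d} S ≗ indCube S′ → S ≡ S′
indCube-injective {n} {suc d} _ eq = ⊆-antisym (diagonal eq) (diagonal (sym ∘ eq))
  where
  diagonal : ∀ {S S′ : Subset n} → indCube {n} {suc d} S ≗ indCube S′ → S ⊆ S′
  diagonal same {y} y∈S = VAll.head (toWitness (subst T (same y⋯y) (fromWitness (all-replicate (suc d) y∈S))))
    where
    y⋯y : Point n (suc d)
    y⋯y = V.replicate (suc d) y

elements : ∀ {n} (s : Subset n) → Vec (Fin n) ∣ s ∣
elements []          = []
elements (true ∷ s)  = F.zero ∷ V.map F.suc (elements s)
elements (false ∷ s) = V.map F.suc (elements s)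

∈⇒∈elements : ∀ {n} {s : Subset n} {t} → t ∈ s → VAny.Any (_≡ t) (elements s)
∈⇒∈elements {s = true ∷ s}  here       = VAny.here refl
∈⇒∈elements {s = true ∷ s}  (there t∈) = VAny.there (VAnyP.map⁺ (VAny.map (cong F.suc) (∈⇒∈elements t∈)))
∈⇒∈elements {s = false ∷ s} (there t∈) = VAnyP.map⁺ (VAny.map (cong F.suc) (∈⇒∈elements t∈))

∈elements⇒∈ : ∀ {n} (s : Subset n) {t} → VAny.Any (_≡ t) (elements s) → t ∈ s
∈elements⇒∈ (true ∷ s)  {F.zero}  _                 = here
∈elements⇒∈ (false ∷ s) {F.zero}  t∈ with () ← proj₂ (VAny.satisfied (VAnyP.map⁻ t∈))
∈elements⇒∈ (true ∷ s)  {F.suc t} (VAny.there t∈)  =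
  there (∈elements⇒∈ s (VAny.map Fin-suc-injective (VAnyP.map⁻ t∈)))
∈elements⇒∈ (false ∷ s) {F.suc t} t∈               =
  there (∈elements⇒∈ s (VAny.map Fin-suc-injective (VAnyP.map⁻ t∈)))

pad : ∀ {A : Set} {m} d → A → Vec A m → m ≤ d → Vec A d
pad zero    a []       _         = []
pad (suc d) a []       _         = a ∷ pad d a [] z≤n
pad (suc d) a (y ∷ ys) (s≤s m≤d) = y ∷ pad d a ys m≤d

∈pad⇒ : ∀ {A : Set} {m} d a (ys : Vec A m) m≤d {t} →
  VAny.Any (_≡ t) (pad d a ys m≤d) → a ≡ t ⊎ VAny.Any (_≡ t) ys
∈pad⇒ (suc d) a []       _         (VAny.here a≡t)  = inj₁ a≡t
∈pad⇒ (suc d) a []       _         (VAny.there t∈)  = ∈pad⇒ d a [] z≤n t∈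
∈pad⇒ (suc d) a (y ∷ ys) (s≤s _)   (VAny.here y≡t)  = inj₂ (VAny.here y≡t)
∈pad⇒ (suc d) a (y ∷ ys) (s≤s m≤d) (VAny.there t∈)  = Sum.map₂ VAny.there (∈pad⇒ d a ys m≤d t∈)

∈⇒∈pad : ∀ {A : Set} {m} d a (ys : Vec A m) m≤d {t} →
  VAny.Any (_≡ t) ys → VAny.Any (_≡ t) (pad d a ys m≤d)
∈⇒∈pad (suc d) a (y ∷ ys) (s≤s _)   (VAny.here y≡t) = VAny.here y≡t
∈⇒∈pad (suc d) a (y ∷ ys) (s≤s m≤d) (VAny.there t∈) = VAny.there (∈⇒∈pad d a ys m≤d t∈)

padding : ∀ {A : Set} {m d} (ys : Vec A m) → 1 ≤ m → m ≤ d →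
  ∃ λ (x : Vec A d) → ∀ t → VAny.Any (_≡ t) x ⇔ VAny.Any (_≡ t) ys
padding {d = d} (y ∷ ys) _ m≤d = pad d y (y ∷ ys) m≤d , λ t → mk⇔ (padded⇒ t) (∈⇒∈pad d y (y ∷ ys) m≤d)
  where
  padded⇒ : ∀ t → VAny.Any (_≡ t) (pad d y (y ∷ ys) m≤d) → VAny.Any (_≡ t) (y ∷ ys)
  padded⇒ t t∈ = Sum.[ VAny.here , id ]′ (∈pad⇒ d y (y ∷ ys) m≤d t∈)

∈coords⇔ : ∀ {n d} (x : Point n d) t → t ∈ coords x ⇔ VAny.Any (_≡ t) x
∈coords⇔ x t = mk⇔
  (λ t∈ → toWitness (from T-≡ (trans (sym (lookup∘tabulate _ t)) ([]=⇒lookup t∈))))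
  (λ t∈ → lookup⇒[]= t (coords x) (trans (lookup∘tabulate _ t) (to T-≡ (fromWitness t∈))))

coords-onto : ∀ {n d} (U : Subset n) → 1 ≤ ∣ U ∣ → ∣ U ∣ ≤ d → ∃ λ (x : Point n d) → coords x ≡ U
coords-onto U 1≤∣U∣ ∣U∣≤d with padding (elements U) 1≤∣U∣ ∣U∣≤d
... | x , same = x , ⊆-antisym
  (λ {t} t∈ → ∈elements⇒∈ U (to (same t) (to (∈coords⇔ x t) t∈)))
  (λ {t} t∈ → from (∈coords⇔ x t) (from (same t) (∈⇒∈elements t∈)))

indV-injective : ∀ {n d} {U U′ : Subset n} → 1 ≤ ∣ U ∣ → ∣ U ∣ ≤ d → indV {n} {d} U ≗ indV U′ → U ≡ U′
indV-injective 1≤∣U∣ ∣U∣≤d eq with coords-onto _ 1≤∣U∣ ∣U∣≤d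
... | x , coords≡U = trans (sym coords≡U) (toWitness (subst T (eq x) (fromWitness coords≡U)))

lemma3p2 : (k d n : ℕ) → 1 ≤ k → 1 ≤ d → 1 ≤ n → 2 * k ≡ d →
  ∃ λ (m : ℕ) →
    ImageSize {Point n d} {Subset n} (InI k) indCube m ×
    ImageSize {Point n d} {Subset n} (λ T → (1 ≤ ∣ T ∣) × (∣ T ∣ ≤ d)) indV m
lemma3p2 k .(2 * k) n _ 1≤d _ refl =
  _ , imageSize-injective (λ _ _ → indCube-injective 1≤d) unions
    , imageSize-injective (λ (1≤∣U∣ , ∣U∣≤d) _ → indV-injective 1≤∣U∣ ∣U∣≤d) shapes
  where
  Shape : Subset n → Set
  Shape U = 1 ≤ ∣ U ∣ × ∣ U ∣ ≤ 2 * k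
  shape? : Decidable Shape
  shape? U = 1 ≤? ∣ U ∣ ×-dec ∣ U ∣ ≤? 2 * k
  shapes : Enumeration Shape (length (filter shape? (allSubsets n)))
  shapes = enumeration-filter shape? (allSubsets-unique n) ∈-allSubsets
  unions : Enumeration (InI k) (length (filter shape? (allSubsets n)))
  unions = enumeration-inverse (changes false) (accumulate false)
    (changes-accumulate false) (accumulate-changes false)
    (to (InI⇔changes-bounded k _))
    (λ {U} shape → from (InI⇔changes-bounded k _) (subst Shape (sym (changes-accumulate false U)) shape))
    shapes
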